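{- Let $G$ be an internally $3$-rank-connected graph, $T$ a triplet of $G$, and $a\in T$. Let $(X,Y)$ be a partition of $V(G)-\{a\}$ such that $\rho_{G\setminus a}(X)\le 2$ and neither $X$ nor $Y$ is sequential in $G\setminus a$. Then there exist $b\in X\cap T$ and $c\in Y\cap T$ such that $\rho_{G\setminus b}(X-\{b\})=\rho_{G\setminus c}(Y-\{c\})=3$.
   Context: Graphs are finite and simple; $G\setminus v$ is deletion. The cut-rank $\rho_G(X)$ is the $\mathrm{GF}(2)$-rank of the $X\times(V(G)-X)$ submatrix of the adjacency matrix. $G$ is prime if there is no partition $(A,B)$ of $V(G)$ with $|A|,|B|\ge2$ and $\rho_G(A)\le1$. $G$ is internally $3$-rank-connected if it is prime and for each $X\subseteq V(G)$ with $\rho_G(X)\le2$, $|X|\le3$ or $|V(G)-X|\le3$. A triplet of $G$ is a $3$-element $T\subseteq V(G)$ with $\rho_G(T)=2$ and $\rho_{G\setminus x}(T-\{x\})=2$ for each $x\in T$. A set $A$ is sequential in $G$ if it has an ordering $a_1,\dots,a_{|A|}$ with $\rho_G(\{a_1,\dots,a_i\})\le2$ for all $i$. -}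

module Defs where

open import Data.Nat using (ℕ; zero; suc; _≤_)
open import Data.Bool using (Bool; true; false; _∧_; _xor_)
open import Data.Fin using (Fin)
open import Data.Fin.Subset using (Subset; _∈_; _∉_; ∁; ⁅_⁆; _∪_; _─_; ∣_∣)
open import Data.Fin.Subset using () renaming (⊤ to all; ⊥ to none)
open import Data.List using (List; []; _∷_; length; take)
open import Data.List.Relation.Unary.Unique.Propositional using (Unique)
import Data.List.Membership.Propositional as LMem
open import Data.Product using (Σ; _×_)
open import Data.Sum using (_⊎_)
open import Data.Empty using (⊥)
open import Relation.Nullary using (¬_)
open import Relation.Binary.PropositionalEquality using (_≡_)
open import Function.Bundles using (_⇔_)

record Graph (n : ℕ) : Set where
  field
    adj   : Fin n → Fin n → Bool
    sym   : ∀ x y → adj x y ≡ adj y x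
    loopless : ∀ x → adj x x ≡ false
open Graph public

lincomb : ∀ {n k} → (Fin k → Bool) → (Fin k → Fin n → Bool) → Fin n → Bool
lincomb {k = zero}  c v y = false
lincomb {k = suc k} c v y =
  (c Fin.zero ∧ v Fin.zero y) xor lincomb (λ i → c (Fin.suc i)) (λ i → v (Fin.suc i)) y

-- Cut-rank of X in the induced subgraph G[W] (W the current vertex set) is at most k:
-- the GF(2)-row space of the (X∩W) × (W−X) submatrix of the adjacency matrix
-- is spanned by k vectors.
CutRankLE : ∀ {n} → Graph n → Subset n → Subset n → ℕ → Set
CutRankLE {n} G W X k =
  Σ (Fin k → Fin n → Bool) λ vs →
    ∀ x → x ∈ X → x ∈ W →
      Σ (Fin k → Bool) λ c →
        ∀ y → y ∈ W → y ∉ X → adj G x y ≡ lincomb c vs y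

CutRankEq : ∀ {n} → Graph n → Subset n → Subset n → ℕ → Set
CutRankEq G W X zero    = CutRankLE G W X zero
CutRankEq G W X (suc r) = CutRankLE G W X (suc r) × ¬ CutRankLE G W X r

del : ∀ {n} → Fin n → Subset n
del v = ∁ ⁅ v ⁆

Prime : ∀ {n} → Graph n → Set
Prime {n} G = ∀ (A : Subset n) → 2 ≤ ∣ A ∣ → 2 ≤ ∣ ∁ A ∣ → ¬ CutRankLE G all A 1

Internally3RankConnected : ∀ {n} → Graph n → Set
Internally3RankConnected {n} G =
  Prime G × (∀ (X : Subset n) → CutRankLE G all X 2 → ∣ X ∣ ≤ 3 ⊎ ∣ ∁ X ∣ ≤ 3)

Triplet : ∀ {n} → Graph n → Subset n → Set
Triplet G T =
  ∣ T ∣ ≡ 3 × CutRankEq G all T 2 ×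
  (∀ x → x ∈ T → CutRankEq G (del x) (T ─ ⁅ x ⁆) 2)

setOf : ∀ {n} → List (Fin n) → Subset n
setOf []       = none
setOf (x ∷ xs) = ⁅ x ⁆ ∪ setOf xs

Sequential : ∀ {n} → Graph n → Subset n → Subset n → Set
Sequential {n} G W A =
  Σ (List (Fin n)) λ l →
    Unique l × (∀ x → (x ∈ A) ⇔ (x LMem.∈ l)) ×
    (∀ i → i ≤ length l → CutRankLE G W (setOf (take i l)) 2)

{-# OPTIONS --safe #-}
-- Let T = {a, b, c}.  The rows of a, b, c on V − T span a space of dimension 2 but are pairwise
-- independent (this is what the triplet condition at each vertex says), so they sum to zero: off T,
-- column a is the sum of columns b and c.  If b and c both lay in Y, adding column a to the
-- X × (Y − {a}) matrix would not raise its rank, so ρ_G(X) ≤ 2, and internal 3-rank-connectivity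
-- would leave X with at most three elements or Y with at most two, making one of them sequential.
-- Hence, say, b ∈ X and c ∈ Y.  Deleting b instead of a costs at most one in rank, so
-- ρ_{G∖b}(X − b) ≤ 3; if it were ≤ 2, the identity b = a + c would give ρ_G(X − b) ≤ 2, and then
-- either |X − b| ≤ 3, so X is sequential (order X − b first and b last), or |Y| ≤ 1.
module Submission where

open import Defs renaming (sym to adj-sym)
open import Algebra.Bundles using (CommutativeRing)
open import Data.Nat using (ℕ; zero; suc; _≤_; s≤s; _≤?_)
open import Data.Nat.Properties using (≤-trans; ≤-reflexive; ≤-pred; ≰⇒>; m⊓n≤m; n≤1+n; +-comm)
open import Data.Bool using (Bool; true; false; _∧_; _xor_; if_then_else_)
import Data.Bool.Properties as Bool
open import Data.Bool.Properties
  using (xor-assoc; xor-comm; xor-same; xor-identityʳ; ∧-comm; ∧-zeroʳ; ∧-identityʳ; ∧-distribˡ-xor; xor-∧-commutativeRing)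
open import Data.Fin using (Fin; zero; suc)
open import Data.Fin.Properties using (_≟_; suc-injective)
open import Data.Fin.Subset using (Subset; _∈_; _∉_; ∁; ⁅_⁆; _∪_; _─_; _-_; _⊆_; ∣_∣; inside; outside)
open import Data.Fin.Subset using () renaming (⊤ to all)
open import Data.Fin.Subset.Properties
  using (∈⊤; ∉⊥; x∈⁅x⁆; x∈⁅y⁆⇒x≡y; x∉⁅y⁆⇒x≢y; x≢y⇒x∉⁅y⁆; x∈∁p⇒x∉p; x∉p⇒x∈∁p; x∈p∪q⁻; x∈p∪q⁺;
         x∈p∧x≢y⇒x∈p-y; x∈p⇒∣p-x∣<∣p∣; p⊆q⇒∣p∣≤∣q∣; ⊆-antisym; _∈?_)
open import Data.Vec using ([]; _∷_; here; there)
open import Data.Vec.Functional using () renaming (_∷_ to _◂_)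
open import Data.List using (List; []; _∷_; _++_; _∷ʳ_; length; take; map)
open import Data.List.Properties using (length-take; take-all; length-++; length-map)
import Data.List.Membership.Propositional as List
open import Data.List.Membership.Propositional.Properties using (∈-map⁺; ∈-map⁻; ∈-++⁺ˡ; ∈-++⁺ʳ; ∈-++⁻)
open import Data.List.Relation.Unary.Any using (here; there)
open import Data.List.Relation.Unary.All as All using ()
open import Data.List.Relation.Unary.AllPairs using ([]; _∷_)
open import Data.List.Relation.Unary.Unique.Propositional using (Unique)
import Data.List.Relation.Unary.Unique.Propositional.Properties as Unique
open import Data.Product using (Σ; _×_; _,_; proj₁; proj₂; map₂) renaming (map to ×-map)
open import Data.Sum using (_⊎_; inj₁; inj₂; [_,_]; swap) renaming (map₂ to ⊎-map₂)
open import Data.Empty using (⊥; ⊥-elim)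
open import Function using (_∘_; id)
open import Function.Bundles using (_⇔_; mk⇔; Equivalence)
open import Relation.Nullary using (¬_; Dec; yes; no; does; contradiction)
open import Relation.Nullary.Decidable using (map′; _×-dec_; _⊎-dec_; from-yes; dec-true; dec-false)
open import Relation.Binary.PropositionalEquality using (_≡_; _≢_; refl; sym; trans; cong; cong₂; subst; module ≡-Reasoning)
open import Algebra.Properties.CommutativeSemigroup
  (CommutativeRing.+-commutativeSemigroup xor-∧-commutativeRing) using (interchange)

private
  variable
    n k : ℕ

x∈p─q⁻ : ∀ {x : Fin n} (p q : Subset n) → x ∈ p ─ q → x ∈ p × x ∉ q
x∈p─q⁻ (inside ∷ p)  (outside ∷ q) here = here , λ ()
x∈p─q⁻ {x = zero} (inside ∷ p)  (inside ∷ q) ()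
x∈p─q⁻ {x = zero} (outside ∷ p) (inside ∷ q) ()
x∈p─q⁻ {x = zero} (outside ∷ p) (outside ∷ q) ()
x∈p─q⁻ (_ ∷ p) (_ ∷ q) (there m) = ×-map there (λ x∉q → λ { (there x∈q) → x∉q x∈q }) (x∈p─q⁻ p q m)

x∈p-y⁻ : ∀ {x y : Fin n} (p : Subset n) → x ∈ p - y → x ∈ p × x ≢ y
x∈p-y⁻ {y = y} p = map₂ x∉⁅y⁆⇒x≢y ∘ x∈p─q⁻ p ⁅ y ⁆

∈∧∉⇒≢ : ∀ {x y : Fin n} {p : Subset n} → x ∈ p → y ∉ p → x ≢ y
∈∧∉⇒≢ {p = p} x∈p y∉p x≡y = y∉p (subst (_∈ p) x≡y x∈p)

∈-del⁺ : ∀ {x v : Fin n} → x ≢ v → x ∈ del v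
∈-del⁺ = x∉p⇒x∈∁p ∘ x≢y⇒x∉⁅y⁆

∈-del⁻ : ∀ {x v : Fin n} → x ∈ del v → x ≢ v
∈-del⁻ = x∉⁅y⁆⇒x≢y ∘ x∈∁p⇒x∉p

x∈p∧∣p∣≤1+m⇒∣p-x∣≤m : ∀ {x : Fin n} {p : Subset n} {m} → x ∈ p → ∣ p ∣ ≤ suc m → ∣ p - x ∣ ≤ m
x∈p∧∣p∣≤1+m⇒∣p-x∣≤m x∈p ∣p∣≤1+m = ≤-pred (≤-trans (x∈p⇒∣p-x∣<∣p∣ x∈p) ∣p∣≤1+m)

elements : Subset n → List (Fin n)
elements []            = []
elements (inside ∷ p)  = zero ∷ map suc (elements p)
elements (outside ∷ p) = map suc (elements p)

length-elements : (p : Subset n) → length (elements p) ≡ ∣ p ∣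
length-elements []            = refl
length-elements (inside ∷ p)  = cong suc (trans (length-map suc (elements p)) (length-elements p))
length-elements (outside ∷ p) = trans (length-map suc (elements p)) (length-elements p)

∈-elements⁺ : ∀ {x : Fin n} (p : Subset n) → x ∈ p → x List.∈ elements p
∈-elements⁺ (inside ∷ p)  here      = here refl
∈-elements⁺ (inside ∷ p)  (there m) = there (∈-map⁺ suc (∈-elements⁺ p m))
∈-elements⁺ (outside ∷ p) (there m) = ∈-map⁺ suc (∈-elements⁺ p m)

∈-elements⁻ : ∀ {x : Fin n} (p : Subset n) → x List.∈ elements p → x ∈ p
∈-elements⁻ (inside ∷ p) (here refl) = here
∈-elements⁻ (inside ∷ p) (there m) with ∈-map⁻ suc m
... | _ , m′ , refl = there (∈-elements⁻ p m′)
∈-elements⁻ (outside ∷ p) m with ∈-map⁻ suc m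
... | _ , m′ , refl = there (∈-elements⁻ p m′)

∈⇔∈-elements : ∀ (p : Subset n) x → x ∈ p ⇔ x List.∈ elements p
∈⇔∈-elements p _ = mk⇔ (∈-elements⁺ p) (∈-elements⁻ p)

elements-unique : (p : Subset n) → Unique (elements p)
elements-unique []            = []
elements-unique (inside ∷ p)  = All.tabulate zero∉ ∷ Unique.map⁺ suc-injective (elements-unique p)
  where
  zero∉ : ∀ {x} → x List.∈ map suc (elements p) → zero ≢ x
  zero∉ m refl with ∈-map⁻ suc m
  ... | _ , _ , ()
elements-unique (outside ∷ p) = Unique.map⁺ suc-injective (elements-unique p)

∈-setOf⁺ : ∀ {x : Fin n} (l : List (Fin n)) → x List.∈ l → x ∈ setOf l
∈-setOf⁺ (y ∷ l) (here refl) = x∈p∪q⁺ (inj₁ (x∈⁅x⁆ y))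
∈-setOf⁺ (y ∷ l) (there m)   = x∈p∪q⁺ (inj₂ (∈-setOf⁺ l m))

∈-setOf⁻ : ∀ {x : Fin n} (l : List (Fin n)) → x ∈ setOf l → x List.∈ l
∈-setOf⁻ []      m = ⊥-elim (∉⊥ m)
∈-setOf⁻ (y ∷ l) m with x∈p∪q⁻ ⁅ y ⁆ (setOf l) m
... | inj₁ m′ = here (x∈⁅y⁆⇒x≡y y m′)
... | inj₂ m′ = there (∈-setOf⁻ l m′)

setOf-≡ : ∀ {A : Subset n} (l : List (Fin n)) → (∀ x → x ∈ A ⇔ x List.∈ l) → setOf l ≡ A
setOf-≡ l A⇔l = ⊆-antisym (λ m → Equivalence.from (A⇔l _) (∈-setOf⁻ l m))
                          (λ m → ∈-setOf⁺ l (Equivalence.to (A⇔l _) m))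

length-take≤ : ∀ {A : Set} i (xs : List A) → length (take i xs) ≤ i
length-take≤ i xs = ≤-trans (≤-reflexive (length-take i xs)) (m⊓n≤m i (length xs))

take-++ˡ : ∀ {A : Set} i (xs ys : List A) → i ≤ length xs → take i (xs ++ ys) ≡ take i xs
take-++ˡ zero    xs       ys _       = refl
take-++ˡ (suc i) (x ∷ xs) ys (s≤s h) = cong (x ∷_) (take-++ˡ i xs ys h)

xor-cancelʳ : ∀ x y → (x xor y) xor y ≡ x
xor-cancelʳ x y = trans (xor-assoc x y y) (trans (cong (x xor_) (xor-same y)) (xor-identityʳ x))

xor-swap : ∀ {x y} z → x ≡ y xor z → y ≡ x xor z
xor-swap {y = y} z refl = sym (xor-cancelʳ y z)

lincomb-cong : ∀ (c : Fin k → Bool) (vs ws : Fin k → Fin n → Bool) {y z} →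
  (∀ i → vs i y ≡ ws i z) → lincomb c vs y ≡ lincomb c ws z
lincomb-cong {k = zero}  c vs ws h = refl
lincomb-cong {k = suc k} c vs ws h =
  cong₂ (λ u w → (c zero ∧ u) xor w) (h zero) (lincomb-cong (c ∘ suc) (vs ∘ suc) (ws ∘ suc) (h ∘ suc))

lincomb-zero : ∀ (vs : Fin k → Fin n → Bool) y → lincomb (λ _ → false) vs y ≡ false
lincomb-zero {k = zero}  vs y = refl
lincomb-zero {k = suc k} vs y = lincomb-zero (vs ∘ suc) y

lincomb-xor : ∀ (c : Fin k → Bool) (vs ws : Fin k → Fin n → Bool) {z y y′} →
  (∀ i → ws i z ≡ vs i y xor vs i y′) → lincomb c ws z ≡ lincomb c vs y xor lincomb c vs y′
lincomb-xor {k = zero}  c vs ws h = refl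
lincomb-xor {k = suc k} c vs ws {z} {y} {y′} h = trans
  (cong₂ (λ u w → (c zero ∧ u) xor w) (h zero) (lincomb-xor (c ∘ suc) (vs ∘ suc) (ws ∘ suc) (h ∘ suc)))
  (trans (cong (_xor (L y xor L y′)) (∧-distribˡ-xor (c zero) (vs zero y) (vs zero y′)))
         (interchange (c zero ∧ vs zero y) (c zero ∧ vs zero y′) (L y) (L y′)))
  where
  L : Fin _ → Bool
  L = lincomb (c ∘ suc) (vs ∘ suc)

lincomb-transpose : ∀ (vs ws : Fin k → Fin n → Bool) y x →
  lincomb (λ i → ws i x) vs y ≡ lincomb (λ i → vs i y) ws x
lincomb-transpose {k = zero}  vs ws y x = refl
lincomb-transpose {k = suc k} vs ws y x =
  cong₂ _xor_ (∧-comm (ws zero x) (vs zero y)) (lincomb-transpose (vs ∘ suc) (ws ∘ suc) y x)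

module _ (G : Graph n) where

  cutRank-submatrix : ∀ (W Z W′ Z′ : Subset n) →
    (∀ {x} → x ∈ Z′ → x ∈ W′ → x ∈ Z × x ∈ W) → (∀ {y} → y ∈ W′ → y ∉ Z′ → y ∈ W × y ∉ Z) →
    CutRankLE G W Z k → CutRankLE G W′ Z′ k
  cutRank-submatrix W Z W′ Z′ rows cols (vs , span) = vs , λ x x∈Z′ x∈W′ →
    let (x∈Z , x∈W) = rows x∈Z′ x∈W′ ; (c , eq) = span x x∈Z x∈W in
    c , λ y y∈W′ y∉Z′ → let (y∈W , y∉Z) = cols y∈W′ y∉Z′ in eq y y∈W y∉Z

  cutRank-transpose : ∀ (W Z Z′ : Subset n) →
    (∀ {x} → x ∈ Z′ → x ∈ W → x ∉ Z) → (∀ {y} → y ∈ W → y ∉ Z′ → y ∈ Z) →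
    CutRankLE G W Z k → CutRankLE G W Z′ k
  cutRank-transpose {k = k} W Z Z′ Z′⊆cols cols⊆Z (vs , span) =
    (λ i x → coefficients x i) , λ y y∈Z′ y∈W → (λ i → vs i y) , λ x x∈W x∉Z′ →
      trans (adj-sym G y x) (trans (coefficients-span x (cols⊆Z x∈W x∉Z′) x∈W y y∈W (Z′⊆cols y∈Z′ y∈W))
        (lincomb-transpose vs (λ i x → coefficients x i) y x))
    where
    coefficients : Fin n → Fin k → Bool
    coefficients x with x ∈? Z | x ∈? W
    ... | yes x∈Z | yes x∈W = proj₁ (span x x∈Z x∈W)
    ... | _       | _       = λ _ → false
    coefficients-span : ∀ x → x ∈ Z → x ∈ W → ∀ y → y ∈ W → y ∉ Z → adj G x y ≡ lincomb (coefficients x) vs y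
    coefficients-span x x∈Z x∈W with x ∈? Z | x ∈? W
    ... | yes x∈Z | yes x∈W = proj₂ (span x x∈Z x∈W)
    ... | no x∉Z  | _       = contradiction x∈Z x∉Z
    ... | yes _   | no x∉W  = contradiction x∈W x∉W

  cutRank-addRow : ∀ (W Z : Subset n) x → CutRankLE G W Z k → CutRankLE G W (⁅ x ⁆ ∪ Z) (suc k)
  cutRank-addRow {k = k} W Z x (vs , span) = (adj G x ◂ vs) , λ z z∈ z∈W → row z (x∈p∪q⁻ ⁅ x ⁆ Z z∈) z∈W
    where
    row : ∀ z → z ∈ ⁅ x ⁆ ⊎ z ∈ Z → z ∈ W → Σ (Fin (suc k) → Bool) λ c →
          ∀ y → y ∈ W → y ∉ ⁅ x ⁆ ∪ Z → adj G z y ≡ lincomb c (adj G x ◂ vs) y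
    row z (inj₁ z∈⁅x⁆) _ rewrite x∈⁅y⁆⇒x≡y x z∈⁅x⁆ =
      (true ◂ λ _ → false) , λ y _ _ → sym (trans (cong (adj G x y xor_) (lincomb-zero vs y)) (xor-identityʳ _))
    row z (inj₂ z∈Z) z∈W = let (c , eq) = span z z∈Z z∈W in
      (false ◂ c) , λ y y∈W y∉ → eq y y∈W (λ y∈Z → y∉ (x∈p∪q⁺ (inj₂ y∈Z)))

  cutRank-setOf : ∀ (W : Subset n) (l : List (Fin n)) → length l ≤ k → CutRankLE G W (setOf l) k
  cutRank-setOf W []      _       = (λ _ _ → false) , λ x x∈∅ _ → ⊥-elim (∉⊥ x∈∅)
  cutRank-setOf W (x ∷ l) (s≤s h) = cutRank-addRow W (setOf l) x (cutRank-setOf W l h)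

  cutRank-≤size : ∀ (W S : Subset n) → ∣ S ∣ ≤ k → CutRankLE G W S k
  cutRank-≤size {k = k} W S ∣S∣≤k =
    subst (λ S → CutRankLE G W S k) (setOf-≡ (elements S) (∈⇔∈-elements S))
      (cutRank-setOf W (elements S) (≤-trans (≤-reflexive (length-elements S)) ∣S∣≤k))

  -- The indicator of v is the new spanning vector; its coefficient corrects the entry at v.
  cutRank-undelete : ∀ (Z : Subset n) {v} → v ∉ Z → CutRankLE G (del v) Z k → CutRankLE G all Z (suc k)
  cutRank-undelete Z {v} v∉Z (vs , span) = ((λ y → does (y ≟ v)) ◂ vs) , λ x x∈Z _ →
    let (c , eq) = span x x∈Z (∈-del⁺ (∈∧∉⇒≢ x∈Z v∉Z)) in
    ((adj G x v xor lincomb c vs v) ◂ c) , λ y _ y∉Z → column x c eq y y∉Z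
    where
    column : ∀ x c → (∀ y → y ∈ del v → y ∉ Z → adj G x y ≡ lincomb c vs y) → ∀ y → y ∉ Z →
             adj G x y ≡ ((adj G x v xor lincomb c vs v) ∧ does (y ≟ v)) xor lincomb c vs y
    column x c eq y y∉Z with y ≟ v
    ... | yes refl = sym (trans (cong (_xor lincomb c vs v) (∧-identityʳ (adj G x v xor lincomb c vs v)))
                                (xor-cancelʳ (adj G x v) (lincomb c vs v)))
    ... | no y≢v   = trans (eq y (∈-del⁺ y≢v) y∉Z)
                       (cong (_xor lincomb c vs y) (sym (∧-zeroʳ (adj G x v xor lincomb c vs v))))

  cutRank-undelete-sum : ∀ (Z : Subset n) {v b c} → v ∉ Z → b ≢ v → b ∉ Z → c ≢ v → c ∉ Z →
    (∀ {x} → x ∈ Z → adj G x v ≡ adj G x b xor adj G x c) →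
    CutRankLE G (del v) Z k → CutRankLE G all Z k
  cutRank-undelete-sum {k = k} Z {v} {b} {c} v∉Z b≢v b∉Z c≢v c∉Z v=b+c (vs , span) = ws , λ x x∈Z _ →
    let (d , eq) = span x x∈Z (∈-del⁺ (∈∧∉⇒≢ x∈Z v∉Z)) in d , λ y _ y∉Z → column x x∈Z d eq y y∉Z
    where
    ws : Fin k → Fin n → Bool
    ws i y = if does (y ≟ v) then vs i b xor vs i c else vs i y
    ws-at-v : ∀ i → ws i v ≡ vs i b xor vs i c
    ws-at-v i rewrite dec-true (v ≟ v) refl = refl
    ws-off-v : ∀ {y} → y ≢ v → ∀ i → vs i y ≡ ws i y
    ws-off-v {y} y≢v i rewrite dec-false (y ≟ v) y≢v = refl
    column : ∀ x → x ∈ Z → ∀ d → (∀ y → y ∈ del v → y ∉ Z → adj G x y ≡ lincomb d vs y) →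
             ∀ y → y ∉ Z → adj G x y ≡ lincomb d ws y
    column x x∈Z d eq y y∉Z with y ≟ v
    ... | yes refl = trans (v=b+c x∈Z)
                       (trans (cong₂ _xor_ (eq b (∈-del⁺ b≢v) b∉Z) (eq c (∈-del⁺ c≢v) c∉Z))
                              (sym (lincomb-xor d vs ws ws-at-v)))
    ... | no y≢v   = trans (eq y (∈-del⁺ y≢v) y∉Z) (lincomb-cong d vs ws (ws-off-v y≢v))

  cutRank≤1-proportional : ∀ (W Z : Subset n) {u w β} →
    (∀ {v} → v ∈ Z → v ∈ W → v ≡ u ⊎ v ≡ w) → (∀ {y} → y ∈ W → y ∉ Z → adj G u y ≡ β ∧ adj G w y) →
    CutRankLE G W Z 1
  cutRank≤1-proportional W Z {u} {w} {β} ⊆uw u=βw = (λ _ → adj G w) , λ v v∈Z v∈W → row v (⊆uw v∈Z v∈W)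
    where
    row : ∀ v → v ≡ u ⊎ v ≡ w →
          Σ (Fin 1 → Bool) λ c → ∀ y → y ∈ W → y ∉ Z → adj G v y ≡ lincomb c (λ _ → adj G w) y
    row v (inj₁ refl) = (λ _ → β) , λ y y∈W y∉Z → trans (u=βw y∈W y∉Z) (sym (xor-identityʳ _))
    row v (inj₂ refl) = (λ _ → true) , λ _ _ _ → sym (xor-identityʳ _)

  sequential-≤3 : ∀ (W S : Subset n) → ∣ S ∣ ≤ 3 → CutRankLE G W S 2 → Sequential G W S
  sequential-≤3 W S ∣S∣≤3 cutRank≤2 = elements S , elements-unique S , ∈⇔∈-elements S , prefix
    where
    prefix : ∀ i → i ≤ length (elements S) → CutRankLE G W (setOf (take i (elements S))) 2
    prefix i _ with i ≤? 2
    ... | yes i≤2 = cutRank-setOf W (take i (elements S)) (≤-trans (length-take≤ i (elements S)) i≤2)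
    ... | no  i≰2 rewrite take-all i (elements S) (≤-trans (≤-trans (≤-reflexive (length-elements S)) ∣S∣≤3) (≰⇒> i≰2))
                        | setOf-≡ (elements S) (∈⇔∈-elements S) = cutRank≤2

  sequential-small : ∀ (W S : Subset n) → ∣ S ∣ ≤ 2 → Sequential G W S
  sequential-small W S ∣S∣≤2 = sequential-≤3 W S (≤-trans ∣S∣≤2 (n≤1+n 2)) (cutRank-≤size W S ∣S∣≤2)

  sequential-snoc : ∀ (W B : Subset n) {b} → b ∈ B → Sequential G W (B - b) → CutRankLE G W B 2 →
    Sequential G W B
  sequential-snoc W B {b} b∈B (l , unique , B-b⇔l , prefix) cutRank≤2 = l ∷ʳ b , unique′ , B⇔l∷ʳb , prefix′
    where
    ∈l⇒≢b : ∀ {x} → x List.∈ l → x ≢ b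
    ∈l⇒≢b m = proj₂ (x∈p-y⁻ B (Equivalence.from (B-b⇔l _) m))
    unique′ : Unique (l ∷ʳ b)
    unique′ = Unique.++⁺ unique (All.[] ∷ []) λ { (m , here refl) → ∈l⇒≢b m refl }
    B⇔l∷ʳb : ∀ x → x ∈ B ⇔ x List.∈ l ∷ʳ b
    B⇔l∷ʳb x = mk⇔ to from
      where
      to : x ∈ B → x List.∈ l ∷ʳ b
      to x∈B with x ≟ b
      ... | yes refl = ∈-++⁺ʳ l (here refl)
      ... | no x≢b   = ∈-++⁺ˡ (Equivalence.to (B-b⇔l x) (x∈p∧x≢y⇒x∈p-y x∈B x≢b))
      from : x List.∈ l ∷ʳ b → x ∈ B
      from m with ∈-++⁻ l m
      ... | inj₁ m′          = proj₁ (x∈p-y⁻ B (Equivalence.from (B-b⇔l x) m′))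
      ... | inj₂ (here refl) = b∈B
    prefix′ : ∀ i → i ≤ length (l ∷ʳ b) → CutRankLE G W (setOf (take i (l ∷ʳ b))) 2
    prefix′ i _ with i ≤? length l
    ... | yes i≤l rewrite take-++ˡ i l (b ∷ []) i≤l = prefix i i≤l
    ... | no  i≰l rewrite take-all i (l ∷ʳ b)
                            (≤-trans (≤-reflexive (trans (length-++ l) (+-comm (length l) 1))) (≰⇒> i≰l))
                        | setOf-≡ (l ∷ʳ b) B⇔l∷ʳb = cutRank≤2

Form : Set
Form = Bool → Bool → Bool

-- The linear form v ↦ p₀v₀ + p₁v₁ on GF(2)², written exactly as lincomb unfolds for two vectors,
-- so that a row spanned by vs is definitionally the form of its coefficients at (vs 0 y, vs 1 y).
form : Bool → Bool → Form
form p₀ p₁ v₀ v₁ = (p₀ ∧ v₀) xor ((p₁ ∧ v₁) xor false)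

_∝_ : Form → Form → Set
f ∝ g = Σ Bool λ β → ∀ v₀ v₁ → f v₀ v₁ ≡ β ∧ g v₀ v₁

Dependent : Form → Form → Set
Dependent f g = f ∝ g ⊎ g ∝ f

SumsToZero : Form → Form → Form → Set
SumsToZero f g h = ∀ v₀ v₁ → (f v₀ v₁ xor g v₀ v₁) xor h v₀ v₁ ≡ false

∀-Bool? : ∀ {P : Bool → Set} → (∀ b → Dec (P b)) → Dec (∀ b → P b)
∀-Bool? P? = map′ (λ (t , f) → λ { true → t ; false → f }) (λ h → h true , h false) (P? true ×-dec P? false)

∃-Bool? : ∀ {P : Bool → Set} → (∀ b → Dec (P b)) → Dec (Σ Bool P)
∃-Bool? P? = map′ [ (true ,_) , (false ,_) ] (λ { (true , p) → inj₁ p ; (false , p) → inj₂ p })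
                  (P? true ⊎-dec P? false)

_∝?_ : ∀ f g → Dec (f ∝ g)
f ∝? g = ∃-Bool? λ β → ∀-Bool? λ v₀ → ∀-Bool? λ v₁ → f v₀ v₁ Bool.≟ β ∧ g v₀ v₁

dependent? : ∀ f g → Dec (Dependent f g)
dependent? f g = (f ∝? g) ⊎-dec (g ∝? f)

sumsToZero? : ∀ f g h → Dec (SumsToZero f g h)
sumsToZero? f g h = ∀-Bool? λ v₀ → ∀-Bool? λ v₁ → (f v₀ v₁ xor g v₀ v₁) xor h v₀ v₁ Bool.≟ false

-- Three vectors of GF(2)² that are pairwise independent are the three nonzero vectors, which sum to
-- zero; checked by evaluating the decision procedure on all 64 coefficient choices.
three-forms : ∀ p₀ p₁ q₀ q₁ r₀ r₁ → let f = form p₀ p₁ ; g = form q₀ q₁ ; h = form r₀ r₁ in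
  SumsToZero f g h ⊎ Dependent f g ⊎ Dependent f h ⊎ Dependent g h
three-forms = from-yes
  (∀-Bool? λ p₀ → ∀-Bool? λ p₁ → ∀-Bool? λ q₀ → ∀-Bool? λ q₁ → ∀-Bool? λ r₀ → ∀-Bool? λ r₁ →
   let f = form p₀ p₁ ; g = form q₀ q₁ ; h = form r₀ r₁ in
   sumsToZero? f g h ⊎-dec dependent? f g ⊎-dec dependent? f h ⊎-dec dependent? g h)

xor≡false⇒≡ : ∀ x y z → (x xor y) xor z ≡ false → x ≡ y xor z
xor≡false⇒≡ x y z sum≡0 = begin
  x                               ≡⟨ sym (xor-cancelʳ x (y xor z)) ⟩
  (x xor (y xor z)) xor (y xor z) ≡⟨ cong (_xor (y xor z)) (trans (sym (xor-assoc x y z)) sum≡0) ⟩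
  y xor z                         ∎
  where open ≡-Reasoning

triplet-column-sum : ∀ (G : Graph n) {T : Subset n} {a b c} → Triplet G T → a ∈ T → b ∈ T → c ∈ T →
  (∀ {v} → v ∈ T → v ≡ a ⊎ v ≡ b ⊎ v ≡ c) → ∀ {x} → x ∉ T → adj G x a ≡ adj G x b xor adj G x c
triplet-column-sum G {T} {a} {b} {c} (_ , ((vs , span) , _) , T-z-cutRank≡2) a∈T b∈T c∈T ⊆abc {x} x∉T =
  dispatch (three-forms (coeff a∈T zero) (coeff a∈T (suc zero)) (coeff b∈T zero) (coeff b∈T (suc zero))
                        (coeff c∈T zero) (coeff c∈T (suc zero)))
  where
  coeff : ∀ {u} → u ∈ T → Fin 2 → Bool
  coeff u∈T = proj₁ (span _ u∈T ∈⊤)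
  row : ∀ {u} → u ∈ T → Form
  row u∈T = form (coeff u∈T zero) (coeff u∈T (suc zero))
  adj≡row : ∀ {u} (u∈T : u ∈ T) {y} → y ∉ T → adj G u y ≡ row u∈T (vs zero y) (vs (suc zero) y)
  adj≡row u∈T {y} y∉T = proj₂ (span _ u∈T ∈⊤) y ∈⊤ y∉T

  ¬proportional : ∀ {z u w β} → z ∈ T → (∀ {v} → v ∈ T → v ≢ z → v ≡ u ⊎ v ≡ w) →
    (∀ {y} → y ∉ T → adj G u y ≡ β ∧ adj G w y) → ⊥
  ¬proportional {z} z∈T T-z⊆uw u=βw = proj₂ (T-z-cutRank≡2 z z∈T)
    (cutRank≤1-proportional G (del z) (T - z)
      (λ v∈T-z _ → let (v∈T , v≢z) = x∈p-y⁻ T v∈T-z in T-z⊆uw v∈T v≢z)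
      (λ y∈del y∉T-z → u=βw (λ y∈T → y∉T-z (x∈p∧x≢y⇒x∈p-y y∈T (∈-del⁻ y∈del)))))

  ¬dependent : ∀ {z u w} → z ∈ T → (u∈T : u ∈ T) (w∈T : w ∈ T) → (∀ {v} → v ∈ T → v ≢ z → v ≡ u ⊎ v ≡ w) →
    ¬ Dependent (row u∈T) (row w∈T)
  ¬dependent z∈T u∈T w∈T T-z⊆uw (inj₁ (β , f=βg)) = ¬proportional z∈T T-z⊆uw λ y∉T →
    trans (adj≡row u∈T y∉T) (trans (f=βg _ _) (cong (β ∧_) (sym (adj≡row w∈T y∉T))))
  ¬dependent z∈T u∈T w∈T T-z⊆uw (inj₂ (β , g=βf)) = ¬proportional z∈T (λ v∈T v≢z → swap (T-z⊆uw v∈T v≢z)) λ y∉T →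
    trans (adj≡row w∈T y∉T) (trans (g=βf _ _) (cong (β ∧_) (sym (adj≡row u∈T y∉T))))

  dispatch : SumsToZero (row a∈T) (row b∈T) (row c∈T) ⊎ Dependent (row a∈T) (row b∈T) ⊎
             Dependent (row a∈T) (row c∈T) ⊎ Dependent (row b∈T) (row c∈T) →
             adj G x a ≡ adj G x b xor adj G x c
  dispatch (inj₁ sum≡0) = begin
    adj G x a               ≡⟨ adj-sym G x a ⟩
    adj G a x               ≡⟨ xor≡false⇒≡ _ _ _ rows-sum≡0 ⟩
    adj G b x xor adj G c x ≡⟨ cong₂ _xor_ (adj-sym G b x) (adj-sym G c x) ⟩
    adj G x b xor adj G x c ∎
    where
    open ≡-Reasoning
    rows-sum≡0 : (adj G a x xor adj G b x) xor adj G c x ≡ false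
    rows-sum≡0 = trans (cong₂ _xor_ (cong₂ _xor_ (adj≡row a∈T x∉T) (adj≡row b∈T x∉T)) (adj≡row c∈T x∉T)) (sum≡0 _ _)
  dispatch (inj₂ (inj₁ ab)) = ⊥-elim (¬dependent c∈T a∈T b∈T
    (λ v∈T v≢c → ⊎-map₂ [ id , (λ v≡c → contradiction v≡c v≢c) ] (⊆abc v∈T)) ab)
  dispatch (inj₂ (inj₂ (inj₁ ac))) = ⊥-elim (¬dependent b∈T a∈T c∈T
    (λ v∈T v≢b → ⊎-map₂ [ (λ v≡b → contradiction v≡b v≢b) , id ] (⊆abc v∈T)) ac)
  dispatch (inj₂ (inj₂ (inj₂ bc))) = ⊥-elim (¬dependent a∈T b∈T c∈T
    (λ v∈T v≢a → [ (λ v≡a → contradiction v≡a v≢a) , id ] (⊆abc v∈T)) bc)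

record OtherTwo {A : Set} (P : A → Set) (a : A) : Set where
  field
    b c  : A
    b∈   : P b
    c∈   : P c
    b≢a  : b ≢ a
    c≢a  : c ≢ a
    ⊆abc : ∀ {v} → P v → v ≡ a ⊎ v ≡ b ⊎ v ≡ c

other-two-list : ∀ {A : Set} {a : A} {l : List A} → Unique l → length l ≡ 3 → a List.∈ l →
  OtherTwo (List._∈ l) a
other-two-list {l = x ∷ y ∷ z ∷ []} ((x≢y All.∷ x≢z All.∷ All.[]) ∷ (y≢z All.∷ All.[]) ∷ _) _ (here refl) =
  record { b = y ; c = z ; b∈ = there (here refl) ; c∈ = there (there (here refl))
         ; b≢a = x≢y ∘ sym ; c≢a = x≢z ∘ sym
         ; ⊆abc = λ { (here e) → inj₁ e ; (there (here e)) → inj₂ (inj₁ e) ; (there (there (here e))) → inj₂ (inj₂ e) } }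
other-two-list {l = x ∷ y ∷ z ∷ []} ((x≢y All.∷ x≢z All.∷ All.[]) ∷ (y≢z All.∷ All.[]) ∷ _) _ (there (here refl)) =
  record { b = x ; c = z ; b∈ = here refl ; c∈ = there (there (here refl))
         ; b≢a = x≢y ; c≢a = y≢z ∘ sym
         ; ⊆abc = λ { (here e) → inj₂ (inj₁ e) ; (there (here e)) → inj₁ e ; (there (there (here e))) → inj₂ (inj₂ e) } }
other-two-list {l = x ∷ y ∷ z ∷ []} ((x≢y All.∷ x≢z All.∷ All.[]) ∷ (y≢z All.∷ All.[]) ∷ _) _ (there (there (here refl))) =
  record { b = x ; c = y ; b∈ = here refl ; c∈ = there (here refl)
         ; b≢a = x≢z ; c≢a = y≢z
         ; ⊆abc = λ { (here e) → inj₂ (inj₁ e) ; (there (here e)) → inj₂ (inj₂ e) ; (there (there (here e))) → inj₁ e } }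

other-two : ∀ {T : Subset n} {a} → ∣ T ∣ ≡ 3 → a ∈ T → OtherTwo (_∈ T) a
other-two {T = T} ∣T∣≡3 a∈T = record
  { b = b ; c = c ; b∈ = ∈-elements⁻ T b∈ ; c∈ = ∈-elements⁻ T c∈ ; b≢a = b≢a ; c≢a = c≢a
  ; ⊆abc = ⊆abc ∘ ∈-elements⁺ T }
  where
  open OtherTwo (other-two-list (elements-unique T) (trans (length-elements T) ∣T∣≡3) (∈-elements⁺ T a∈T))

record NonSequentialSeparation (G : Graph n) (a : Fin n) (Z Z′ : Subset n) : Set where
  field
    a∉Z              : a ∉ Z
    a∉Z′             : a ∉ Z′
    covers           : ∀ {v} → v ≢ a → v ∈ Z ⊎ v ∈ Z′
    disjoint         : ∀ {v} → v ∈ Z → v ∉ Z′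
    cutRank≤2        : CutRankLE G (del a) Z 2
    Z-nonsequential  : ¬ Sequential G (del a) Z
    Z′-nonsequential : ¬ Sequential G (del a) Z′

separation-sym : ∀ {G : Graph n} {a Z Z′} → NonSequentialSeparation G a Z Z′ → NonSequentialSeparation G a Z′ Z
separation-sym {G = G} {a} {Z} {Z′} S = record
  { a∉Z = a∉Z′ ; a∉Z′ = a∉Z ; covers = swap ∘ covers ; disjoint = λ v∈Z′ v∈Z → disjoint v∈Z v∈Z′
  ; cutRank≤2 = cutRank-transpose G (del a) Z Z′ (λ x∈Z′ _ x∈Z → disjoint x∈Z x∈Z′)
      (λ y∈del y∉Z′ → [ id , (λ y∈Z′ → contradiction y∈Z′ y∉Z′) ] (covers (∈-del⁻ y∈del))) cutRank≤2
  ; Z-nonsequential = Z′-nonsequential ; Z′-nonsequential = Z-nonsequential }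
  where open NonSequentialSeparation S

module _ {G : Graph n} (small-side : ∀ X → CutRankLE G all X 2 → ∣ X ∣ ≤ 3 ⊎ ∣ ∁ X ∣ ≤ 3)
         {a Z Z′} (S : NonSequentialSeparation G a Z Z′) where
  open NonSequentialSeparation S

  ∈Z⇒≢a : ∀ {x} → x ∈ Z → x ≢ a
  ∈Z⇒≢a x∈Z = ∈∧∉⇒≢ x∈Z a∉Z

  ∈Z′⇒≢a : ∀ {x} → x ∈ Z′ → x ≢ a
  ∈Z′⇒≢a x∈Z′ = ∈∧∉⇒≢ x∈Z′ a∉Z′

  ∈Z′⇒∉Z : ∀ {x} → x ∈ Z′ → x ∉ Z
  ∈Z′⇒∉Z x∈Z′ x∈Z = disjoint x∈Z x∈Z′

  ¬cutRank≤2-in-G : ¬ CutRankLE G all Z 2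
  ¬cutRank≤2-in-G r with small-side Z r
  ... | inj₁ ∣Z∣≤3  = Z-nonsequential (sequential-≤3 G (del a) Z ∣Z∣≤3 cutRank≤2)
  ... | inj₂ ∣∁Z∣≤3 = Z′-nonsequential (sequential-small G (del a) Z′
          (≤-trans (p⊆q⇒∣p∣≤∣q∣ Z′⊆∁Z-a) (x∈p∧∣p∣≤1+m⇒∣p-x∣≤m (x∉p⇒x∈∁p a∉Z) ∣∁Z∣≤3)))
    where
    Z′⊆∁Z-a : Z′ ⊆ ∁ Z - a
    Z′⊆∁Z-a x∈Z′ = x∈p∧x≢y⇒x∈p-y (x∉p⇒x∈∁p (∈Z′⇒∉Z x∈Z′)) (∈Z′⇒≢a x∈Z′)

  module _ {T : Subset n} {p q} (⊆apq : ∀ {v} → v ∈ T → v ≡ a ⊎ v ≡ p ⊎ v ≡ q)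
           (a=p+q : ∀ {x} → x ∉ T → adj G x a ≡ adj G x p xor adj G x q) where

    T∩Z⊆pq : ∀ {x} → x ∈ Z → x ∈ T → x ≡ p ⊎ x ≡ q
    T∩Z⊆pq x∈Z x∈T = [ (λ x≡a → contradiction x≡a (∈Z⇒≢a x∈Z)) , id ] (⊆apq x∈T)

    ¬both-in-Z′ : p ∈ Z′ → q ∈ Z′ → ⊥
    ¬both-in-Z′ p∈Z′ q∈Z′ = ¬cutRank≤2-in-G
      (cutRank-undelete-sum G Z a∉Z (∈Z′⇒≢a p∈Z′) (∈Z′⇒∉Z p∈Z′) (∈Z′⇒≢a q∈Z′) (∈Z′⇒∉Z q∈Z′)
        (a=p+q ∘ ∉T) cutRank≤2)
      where
      ∉T : ∀ {x} → x ∈ Z → x ∉ T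
      ∉T x∈Z x∈T = [ (λ { refl → disjoint x∈Z p∈Z′ }) , (λ { refl → disjoint x∈Z q∈Z′ }) ] (T∩Z⊆pq x∈Z x∈T)

    deletion-cutRank≡3 : p ∈ Z → q ∈ Z′ → CutRankEq G (del p) (Z - p) 3
    deletion-cutRank≡3 p∈Z q∈Z′ = upper , lower
      where
      p∉Z-p : p ∉ Z - p
      p∉Z-p m = proj₂ (x∈p-y⁻ Z m) refl

      upper : CutRankLE G (del p) (Z - p) 3
      upper = cutRank-submatrix G all Z (del p) (Z - p) (λ x∈Z-p _ → proj₁ (x∈p-y⁻ Z x∈Z-p) , ∈⊤)
                (λ y∈del y∉Z-p → ∈⊤ , λ y∈Z → y∉Z-p (x∈p∧x≢y⇒x∈p-y y∈Z (∈-del⁻ y∈del)))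
                (cutRank-undelete G Z a∉Z cutRank≤2)

      p=a+q : ∀ {x} → x ∈ Z - p → adj G x p ≡ adj G x a xor adj G x q
      p=a+q x∈Z-p = xor-swap (adj G _ q) (a=p+q x∉T)
        where
        x∉T : _ ∉ T
        x∉T x∈T = let (x∈Z , x≢p) = x∈p-y⁻ Z x∈Z-p in
          [ x≢p , (λ { refl → disjoint x∈Z q∈Z′ }) ] (T∩Z⊆pq x∈Z x∈T)

      lower : ¬ CutRankLE G (del p) (Z - p) 2
      lower r = [ Z-sequential , Z′-sequential ] (small-side (Z - p) r′)
        where
        r′ : CutRankLE G all (Z - p) 2
        r′ = cutRank-undelete-sum G (Z - p) p∉Z-p (∈Z⇒≢a p∈Z ∘ sym) (λ m → a∉Z (proj₁ (x∈p-y⁻ Z m)))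
               (∈∧∉⇒≢ q∈Z′ (λ p∈Z′ → disjoint p∈Z p∈Z′)) (λ m → ∈Z′⇒∉Z q∈Z′ (proj₁ (x∈p-y⁻ Z m))) p=a+q r
        Z-sequential : ∣ Z - p ∣ ≤ 3 → ⊥
        Z-sequential ∣Z-p∣≤3 = Z-nonsequential (sequential-snoc G (del a) Z p∈Z
          (sequential-≤3 G (del a) (Z - p) ∣Z-p∣≤3
            (cutRank-submatrix G all (Z - p) (del a) (Z - p) (λ m _ → m , ∈⊤) (λ _ m → ∈⊤ , m) r′))
          cutRank≤2)
        Z′-sequential : ∣ ∁ (Z - p) ∣ ≤ 3 → ⊥
        Z′-sequential ∣C∣≤3 = Z′-nonsequential (sequential-small G (del a) Z′
          (≤-trans (p⊆q⇒∣p∣≤∣q∣ Z′⊆C-a-p)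
            (≤-trans (x∈p∧∣p∣≤1+m⇒∣p-x∣≤m p∈C-a (x∈p∧∣p∣≤1+m⇒∣p-x∣≤m a∈C ∣C∣≤3)) (n≤1+n 1))))
          where
          a∈C : a ∈ ∁ (Z - p)
          a∈C = x∉p⇒x∈∁p (λ m → a∉Z (proj₁ (x∈p-y⁻ Z m)))
          p∈C-a : p ∈ ∁ (Z - p) - a
          p∈C-a = x∈p∧x≢y⇒x∈p-y (x∉p⇒x∈∁p p∉Z-p) (∈Z⇒≢a p∈Z)
          Z′⊆C-a-p : Z′ ⊆ ∁ (Z - p) - a - p
          Z′⊆C-a-p x∈Z′ = x∈p∧x≢y⇒x∈p-y
            (x∈p∧x≢y⇒x∈p-y (x∉p⇒x∈∁p (λ m → ∈Z′⇒∉Z x∈Z′ (proj₁ (x∈p-y⁻ Z m)))) (∈Z′⇒≢a x∈Z′))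
            (∈∧∉⇒≢ x∈Z′ (λ p∈Z′ → disjoint p∈Z p∈Z′))

lemma5p3 : ∀ {n} (G : Graph n) (T : Subset n) (a : Fin n) (X Y : Subset n) →
    Internally3RankConnected G → Triplet G T → a ∈ T →
    a ∉ X → a ∉ Y → (∀ v → v ≢ a → v ∈ X ⊎ v ∈ Y) → (∀ v → v ∈ X → v ∉ Y) →
    CutRankLE G (del a) X 2 →
    ¬ Sequential G (del a) X → ¬ Sequential G (del a) Y →
    Σ (Fin n) λ b → Σ (Fin n) λ c →
      b ∈ X × b ∈ T × c ∈ Y × c ∈ T ×
      CutRankEq G (del b) (X ─ ⁅ b ⁆) 3 × CutRankEq G (del c) (Y ─ ⁅ c ⁆) 3
lemma5p3 G T a X Y (_ , small-side) triplet@(∣T∣≡3 , _) a∈T a∉X a∉Y cover disjoint cutRank≤2 X-nonseq Y-nonseq =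
  choose (cover b b≢a) (cover c c≢a)
  where
  open OtherTwo (other-two ∣T∣≡3 a∈T) renaming (b∈ to b∈T; c∈ to c∈T)

  SX : NonSequentialSeparation G a X Y
  SX = record { a∉Z = a∉X ; a∉Z′ = a∉Y ; covers = λ {v} → cover v ; disjoint = λ {v} → disjoint v
              ; cutRank≤2 = cutRank≤2 ; Z-nonsequential = X-nonseq ; Z′-nonsequential = Y-nonseq }
  SY : NonSequentialSeparation G a Y X
  SY = separation-sym SX

  ⊆acb : ∀ {v} → v ∈ T → v ≡ a ⊎ v ≡ c ⊎ v ≡ b
  ⊆acb v∈T = ⊎-map₂ swap (⊆abc v∈T)
  a=b+c : ∀ {x} → x ∉ T → adj G x a ≡ adj G x b xor adj G x c
  a=b+c = triplet-column-sum G triplet a∈T b∈T c∈T ⊆abc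
  a=c+b : ∀ {x} → x ∉ T → adj G x a ≡ adj G x c xor adj G x b
  a=c+b {x} x∉T = trans (a=b+c x∉T) (xor-comm (adj G x b) (adj G x c))

  choose : b ∈ X ⊎ b ∈ Y → c ∈ X ⊎ c ∈ Y →
    Σ (Fin _) λ b → Σ (Fin _) λ c →
      b ∈ X × b ∈ T × c ∈ Y × c ∈ T × CutRankEq G (del b) (X - b) 3 × CutRankEq G (del c) (Y - c) 3
  choose (inj₁ b∈X) (inj₁ c∈X) = ⊥-elim (¬both-in-Z′ small-side SY ⊆abc a=b+c b∈X c∈X)
  choose (inj₂ b∈Y) (inj₂ c∈Y) = ⊥-elim (¬both-in-Z′ small-side SX ⊆abc a=b+c b∈Y c∈Y)
  choose (inj₁ b∈X) (inj₂ c∈Y) = b , c , b∈X , b∈T , c∈Y , c∈T ,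
    deletion-cutRank≡3 small-side SX ⊆abc a=b+c b∈X c∈Y , deletion-cutRank≡3 small-side SY ⊆acb a=c+b c∈Y b∈X
  choose (inj₂ b∈Y) (inj₁ c∈X) = c , b , c∈X , c∈T , b∈Y , b∈T ,
    deletion-cutRank≡3 small-side SX ⊆acb a=c+b c∈X b∈Y , deletion-cutRank≡3 small-side SY ⊆abc a=b+c b∈Y c∈X
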